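{- The Petersen graph is not factorable.
   Context: A graph $G$ is factorable if there exist simple undirected graphs $H,K$ on the vertex set $V(G)$ with $A=BC$, where $A,B,C$ are the adjacency matrices of $G,H,K$ with respect to one common ordering of the vertices. -}

module Defs where

open import Data.Nat using (ℕ; zero; suc; _+_; _*_)
open import Data.Bool using (Bool; true; false; if_then_else_; _∧_; not; _∨_)
open import Data.Fin using (Fin)
open import Data.Fin.Properties using (_≟_)
open import Data.Product using (Σ; _×_; _,_; ∃₂)
open import Relation.Binary.PropositionalEquality using (_≡_)
open import Relation.Nullary.Decidable using (⌊_⌋)
open import Data.Vec using (Vec; []; _∷_; lookup)

record SimpleGraph (n : ℕ) : Set where
  field
    Adj   : Fin n → Fin n → Bool
    sym   : ∀ i j → Adj i j ≡ Adj j i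
    loopless : ∀ i → Adj i i ≡ false
open SimpleGraph public

Matrix : ℕ → Set
Matrix n = Fin n → Fin n → ℕ

∑ : ∀ {n} → (Fin n → ℕ) → ℕ
∑ {zero}  f = 0
∑ {suc n} f = f Fin.zero + ∑ (λ i → f (Fin.suc i))

_⊗_ : ∀ {n} → Matrix n → Matrix n → Matrix n
(B ⊗ C) i j = ∑ (λ k → B i k * C k j)

adjMatrix : ∀ {n} → SimpleGraph n → Matrix n
adjMatrix G i j = if Adj G i j then 1 else 0

Factorable : ∀ {n} → SimpleGraph n → Set
Factorable {n} G =
  Σ (SimpleGraph n) λ H → Σ (SimpleGraph n) λ K →
    ∀ i j → adjMatrix G i j ≡ (adjMatrix H ⊗ adjMatrix K) i j

-- The Petersen graph, as the Kneser graph K(5,2): vertices are the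
-- 2-element subsets of {0,…,4}, adjacent iff disjoint.

pairs : Vec (Fin 5 × Fin 5) 10
pairs = (# 0 , # 1) ∷ (# 0 , # 2) ∷ (# 0 , # 3) ∷ (# 0 , # 4) ∷ (# 1 , # 2)
      ∷ (# 1 , # 3) ∷ (# 1 , # 4) ∷ (# 2 , # 3) ∷ (# 2 , # 4) ∷ (# 3 , # 4) ∷ []
  where open import Data.Fin using (#_)

private
  eqF : Fin 5 → Fin 5 → Bool
  eqF x y = ⌊ x ≟ y ⌋

disjoint : Fin 5 × Fin 5 → Fin 5 × Fin 5 → Bool
disjoint (a , b) (c , d) =
  not (eqF a c ∨ eqF a d ∨ eqF b c ∨ eqF b d)

petersenAdj : Fin 10 → Fin 10 → Bool
petersenAdj i j = disjoint (lookup pairs i) (lookup pairs j)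

Petersen : SimpleGraph 10
Petersen = record
  { Adj = petersenAdj
  ; sym = symP
  ; loopless = loopP
  }
  where
  open import Data.Fin.Patterns
  loopP : ∀ i → petersenAdj i i ≡ false
  loopP 0F = _≡_.refl
  loopP 1F = _≡_.refl
  loopP 2F = _≡_.refl
  loopP 3F = _≡_.refl
  loopP 4F = _≡_.refl
  loopP 5F = _≡_.refl
  loopP 6F = _≡_.refl
  loopP 7F = _≡_.refl
  loopP 8F = _≡_.refl
  loopP 9F = _≡_.refl
  symP : ∀ i j → petersenAdj i j ≡ petersenAdj j i
  symP 0F 0F = _≡_.refl
  symP 0F 1F = _≡_.refl
  symP 0F 2F = _≡_.refl
  symP 0F 3F = _≡_.refl
  symP 0F 4F = _≡_.refl
  symP 0F 5F = _≡_.refl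
  symP 0F 6F = _≡_.refl
  symP 0F 7F = _≡_.refl
  symP 0F 8F = _≡_.refl
  symP 0F 9F = _≡_.refl
  symP 1F 0F = _≡_.refl
  symP 1F 1F = _≡_.refl
  symP 1F 2F = _≡_.refl
  symP 1F 3F = _≡_.refl
  symP 1F 4F = _≡_.refl
  symP 1F 5F = _≡_.refl
  symP 1F 6F = _≡_.refl
  symP 1F 7F = _≡_.refl
  symP 1F 8F = _≡_.refl
  symP 1F 9F = _≡_.refl
  symP 2F 0F = _≡_.refl
  symP 2F 1F = _≡_.refl
  symP 2F 2F = _≡_.refl
  symP 2F 3F = _≡_.refl
  symP 2F 4F = _≡_.refl
  symP 2F 5F = _≡_.refl
  symP 2F 6F = _≡_.refl
  symP 2F 7F = _≡_.refl
  symP 2F 8F = _≡_.refl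
  symP 2F 9F = _≡_.refl
  symP 3F 0F = _≡_.refl
  symP 3F 1F = _≡_.refl
  symP 3F 2F = _≡_.refl
  symP 3F 3F = _≡_.refl
  symP 3F 4F = _≡_.refl
  symP 3F 5F = _≡_.refl
  symP 3F 6F = _≡_.refl
  symP 3F 7F = _≡_.refl
  symP 3F 8F = _≡_.refl
  symP 3F 9F = _≡_.refl
  symP 4F 0F = _≡_.refl
  symP 4F 1F = _≡_.refl
  symP 4F 2F = _≡_.refl
  symP 4F 3F = _≡_.refl
  symP 4F 4F = _≡_.refl
  symP 4F 5F = _≡_.refl
  symP 4F 6F = _≡_.refl
  symP 4F 7F = _≡_.refl
  symP 4F 8F = _≡_.refl
  symP 4F 9F = _≡_.refl
  symP 5F 0F = _≡_.refl
  symP 5F 1F = _≡_.refl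
  symP 5F 2F = _≡_.refl
  symP 5F 3F = _≡_.refl
  symP 5F 4F = _≡_.refl
  symP 5F 5F = _≡_.refl
  symP 5F 6F = _≡_.refl
  symP 5F 7F = _≡_.refl
  symP 5F 8F = _≡_.refl
  symP 5F 9F = _≡_.refl
  symP 6F 0F = _≡_.refl
  symP 6F 1F = _≡_.refl
  symP 6F 2F = _≡_.refl
  symP 6F 3F = _≡_.refl
  symP 6F 4F = _≡_.refl
  symP 6F 5F = _≡_.refl
  symP 6F 6F = _≡_.refl
  symP 6F 7F = _≡_.refl
  symP 6F 8F = _≡_.refl
  symP 6F 9F = _≡_.refl
  symP 7F 0F = _≡_.refl
  symP 7F 1F = _≡_.refl
  symP 7F 2F = _≡_.refl
  symP 7F 3F = _≡_.refl
  symP 7F 4F = _≡_.refl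
  symP 7F 5F = _≡_.refl
  symP 7F 6F = _≡_.refl
  symP 7F 7F = _≡_.refl
  symP 7F 8F = _≡_.refl
  symP 7F 9F = _≡_.refl
  symP 8F 0F = _≡_.refl
  symP 8F 1F = _≡_.refl
  symP 8F 2F = _≡_.refl
  symP 8F 3F = _≡_.refl
  symP 8F 4F = _≡_.refl
  symP 8F 5F = _≡_.refl
  symP 8F 6F = _≡_.refl
  symP 8F 7F = _≡_.refl
  symP 8F 8F = _≡_.refl
  symP 8F 9F = _≡_.refl
  symP 9F 0F = _≡_.refl
  symP 9F 1F = _≡_.refl
  symP 9F 2F = _≡_.refl
  symP 9F 3F = _≡_.refl
  symP 9F 4F = _≡_.refl
  symP 9F 5F = _≡_.refl
  symP 9F 6F = _≡_.refl
  symP 9F 7F = _≡_.refl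
  symP 9F 8F = _≡_.refl
  symP 9F 9F = _≡_.refl

-- If A(G) = A(H) A(K), then for every edge ij of G there is exactly one vertex k with
-- ik ∈ H and kj ∈ K.  Writing k' for the vertex attached in the same way to ji, the path
-- k –H– i –K– k' shows that kk' is an edge of G whose attached vertices are i and j again.
-- So ij ↦ kk' is an involution on the edges of G, without fixed points because k is
-- neither i nor j.  Hence a factorable graph has an even number of edges, while the
-- Petersen graph has 15.
module Submission where

open import Defs hiding (sym)
open import Data.Bool using (true; false) renaming (_≟_ to _≟ᵇ_)
open import Data.Fin using (Fin; _<_; _≤?_; _<?_; _≟_)
open import Data.Fin.Properties using (any?; ≤-antisym; ≤∧≢⇒<)
open import Data.List using (List; []; _∷_; length; filter; cartesianProduct; allFin)
open import Data.List.Membership.Propositional using (_∈_)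
open import Data.List.Membership.Propositional.Properties
  using (∈-filter⁺; ∈-filter⁻; ∈-cartesianProduct⁺; ∈-allFin)
open import Data.List.Properties using (filter-all; filter-accept; filter-reject)
open import Data.List.Relation.Unary.All as All using ()
open import Data.List.Relation.Unary.AllPairs using (_∷_)
open import Data.List.Relation.Unary.Any using (here; there)
open import Data.List.Relation.Unary.Unique.Propositional using (Unique)
import Data.List.Relation.Unary.Unique.Propositional.Properties as Unique
open import Data.Nat as ℕ using (ℕ; suc; _+_; _*_)
open import Data.Nat.Divisibility using (_∣_; _∣?_; divides; ∣-refl; ∣m∣n⇒∣m+n)
open import Data.Nat.Induction using (<-wellFounded)
open import Data.Nat.Properties as ℕ
  using (m≤m+n; m≤n+m; +-monoʳ-≤; +-comm; ≤-trans; ≤-reflexive; m≤n⇒m≤1+n; <⇒≤; ≰⇒>; module ≤-Reasoning)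
open import Data.Product using (_×_; _,_; proj₁; proj₂)
open import Data.Product.Properties using (≡-dec)
open import Data.Sum using (_⊎_; inj₁; inj₂; [_,_]′)
open import Function using (_∘_)
open import Induction.WellFounded using (Acc; acc)
open import Relation.Binary.Definitions using (DecidableEquality)
open import Relation.Binary.PropositionalEquality
  using (_≡_; _≢_; refl; sym; trans; cong; cong₂; subst; module ≡-Reasoning)
open import Relation.Nullary using (¬_; yes; no; ¬?; contradiction)
open import Relation.Nullary.Decidable using (_×-dec_; from-no)
open import Relation.Unary using (Decidable)

record FreeInvolutionOn {A : Set} (σ : A → A) (xs : List A) : Set where
  field
    closed       : ∀ {x} → x ∈ xs → σ x ∈ xs
    involutive   : ∀ {x} → x ∈ xs → σ (σ x) ≡ x
    fixpointFree : ∀ {x} → x ∈ xs → σ x ≢ x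

module _ {A : Set} (_≟_ : DecidableEquality A) where

  without : A → List A → List A
  without y = filter (λ x → ¬? (y ≟ x))

  ∈-without⁺ : ∀ {x y xs} → x ∈ xs → y ≢ x → x ∈ without y xs
  ∈-without⁺ = ∈-filter⁺ (λ x → ¬? (_ ≟ x))

  length-without : ∀ {y xs} → Unique xs → y ∈ xs → length xs ≡ suc (length (without y xs))
  length-without {y} {x ∷ xs} (x∉xs ∷ _) (here refl)
    rewrite filter-reject (λ z → ¬? (y ≟ z)) {xs = xs} (λ y≢y → y≢y refl)
          | filter-all (λ z → ¬? (y ≟ z)) x∉xs = refl
  length-without {y} {x ∷ xs} (x∉xs ∷ xs!) (there y∈xs)
    rewrite filter-accept (λ z → ¬? (y ≟ z)) {xs = xs} (λ y≡x → All.lookup x∉xs y∈xs (sym y≡x))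
    = cong suc (length-without xs! y∈xs)

  freeInvolution-without : ∀ {σ x xs} → Unique (x ∷ xs) → FreeInvolutionOn σ (x ∷ xs) →
                           FreeInvolutionOn σ (without (σ x) xs)
  freeInvolution-without {σ} {x} {xs} (x∉xs ∷ _) inv = record
    { closed       = closed′ ∘ ∈-filter⁻ _
    ; involutive   = involutive ∘ there ∘ proj₁ ∘ ∈-filter⁻ _
    ; fixpointFree = fixpointFree ∘ there ∘ proj₁ ∘ ∈-filter⁻ _
    }
    where
    open FreeInvolutionOn inv
    closed′ : ∀ {z} → z ∈ xs × σ x ≢ z → σ z ∈ without (σ x) xs
    closed′ {z} (z∈xs , σx≢z) with closed (there z∈xs)
    ... | here σz≡x = contradiction (trans (cong σ (sym σz≡x)) (involutive (there z∈xs))) σx≢z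
    ... | there σz∈xs = ∈-without⁺ σz∈xs λ σx≡σz →
      All.lookup x∉xs z∈xs (trans (sym (involutive (here refl)))
                               (trans (cong σ σx≡σz) (involutive (there z∈xs))))

  freeInvolution⇒2∣length : ∀ {σ xs} → Unique xs → FreeInvolutionOn σ xs → 2 ∣ length xs
  freeInvolution⇒2∣length {σ} {xs} = go xs (<-wellFounded (length xs))
    where
    go : ∀ xs → Acc ℕ._<_ (length xs) → Unique xs → FreeInvolutionOn σ xs → 2 ∣ length xs
    go []       _         _   _   = divides 0 refl
    go (x ∷ xs) (acc rec) x∷xs!@(_ ∷ xs!) inv with FreeInvolutionOn.closed inv (here refl)
    ... | here σx≡x = contradiction σx≡x (FreeInvolutionOn.fixpointFree inv (here refl))
    ... | there σx∈xs =
      subst (2 ∣_) (cong suc (sym |xs|≡1+|ys|))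
        (∣m∣n⇒∣m+n ∣-refl (go ys (rec (m≤n⇒m≤1+n (≤-reflexive (sym |xs|≡1+|ys|))))
          (Unique.filter⁺ _ xs!) (freeInvolution-without x∷xs! inv)))
      where
      ys = without (σ x) xs
      |xs|≡1+|ys| : length xs ≡ suc (length ys)
      |xs|≡1+|ys| = length-without xs! σx∈xs

∑-≥-summand : ∀ {n} (f : Fin n → ℕ) k → f k ℕ.≤ ∑ f
∑-≥-summand f Fin.zero    = m≤m+n _ _
∑-≥-summand f (Fin.suc k) = ≤-trans (∑-≥-summand (f ∘ Fin.suc) k) (m≤n+m _ _)

∑-≥-pair : ∀ {n} (f : Fin n → ℕ) {a b} → a ≢ b → f a + f b ℕ.≤ ∑ f
∑-≥-pair f {Fin.zero}  {Fin.zero}  a≢b = contradiction refl a≢b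
∑-≥-pair f {Fin.zero}  {Fin.suc b} _   = +-monoʳ-≤ (f Fin.zero) (∑-≥-summand (f ∘ Fin.suc) b)
∑-≥-pair f {Fin.suc a} {Fin.zero}  _   =
  subst (ℕ._≤ ∑ f) (+-comm (f Fin.zero) _) (+-monoʳ-≤ (f Fin.zero) (∑-≥-summand (f ∘ Fin.suc) a))
∑-≥-pair f {Fin.suc a} {Fin.suc b} a≢b =
  ≤-trans (∑-≥-pair (f ∘ Fin.suc) (a≢b ∘ cong Fin.suc)) (m≤n+m _ _)

∑-zero : ∀ {n} (f : Fin n → ℕ) → (∀ k → f k ≡ 0) → ∑ f ≡ 0
∑-zero {ℕ.zero} f _     = refl
∑-zero {suc n}  f f≡0 rewrite f≡0 Fin.zero = ∑-zero (f ∘ Fin.suc) (f≡0 ∘ Fin.suc)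

module _ {n} (G : SimpleGraph n) where

  adj-sym : ∀ {i j} → Adj G i j ≡ true → Adj G j i ≡ true
  adj-sym {i} {j} = trans (SimpleGraph.sym G j i)

  adj⇒≢ : ∀ {i j} → Adj G i j ≡ true → i ≢ j
  adj⇒≢ {i} e refl with () ← trans (sym e) (loopless G i)

  adjMatrix≤1 : ∀ i j → adjMatrix G i j ℕ.≤ 1
  adjMatrix≤1 i j with Adj G i j
  ... | true  = ℕ.s≤s ℕ.z≤n
  ... | false = ℕ.z≤n

  adj⇒adjMatrix≡1 : ∀ {i j} → Adj G i j ≡ true → adjMatrix G i j ≡ 1
  adj⇒adjMatrix≡1 e rewrite e = refl

  IsEdge : Fin n × Fin n → Set
  IsEdge (i , j) = Adj G i j ≡ true × i < j

  isEdge? : Decidable IsEdge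
  isEdge? (i , j) = (Adj G i j ≟ᵇ true) ×-dec (i <? j)

  edges : List (Fin n × Fin n)
  edges = filter isEdge? (cartesianProduct (allFin n) (allFin n))

  edges-unique : Unique edges
  edges-unique = Unique.filter⁺ isEdge? (Unique.cartesianProduct⁺ (Unique.allFin⁺ n) (Unique.allFin⁺ n))

  ∈-edges⁺ : ∀ {p} → IsEdge p → p ∈ edges
  ∈-edges⁺ {i , j} = ∈-filter⁺ isEdge? (∈-cartesianProduct⁺ (∈-allFin i) (∈-allFin j))

  ∈-edges⁻ : ∀ {p} → p ∈ edges → IsEdge p
  ∈-edges⁻ = proj₂ ∘ ∈-filter⁻ isEdge? {xs = cartesianProduct (allFin n) (allFin n)}

sortPair : ∀ {n} → Fin n → Fin n → Fin n × Fin n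
sortPair a b with a ≤? b
... | yes _ = a , b
... | no  _ = b , a

sortPair-comm : ∀ {n} (a b : Fin n) → sortPair a b ≡ sortPair b a
sortPair-comm a b with a ≤? b | b ≤? a
... | yes a≤b | yes b≤a rewrite ≤-antisym a≤b b≤a = refl
... | yes _   | no  _   = refl
... | no  _   | yes _   = refl
... | no  a≰b | no  b≰a = contradiction (<⇒≤ (≰⇒> a≰b)) b≰a

sortPair-< : ∀ {n} {a b : Fin n} → a < b → sortPair a b ≡ (a , b)
sortPair-< {a = a} {b} a<b with a ≤? b
... | yes _   = refl
... | no  a≰b = contradiction (<⇒≤ a<b) a≰b

sortPair-cases : ∀ {n} (a b : Fin n) → sortPair a b ≡ (a , b) ⊎ sortPair a b ≡ (b , a)
sortPair-cases a b with a ≤? b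
... | yes _ = inj₁ refl
... | no  _ = inj₂ refl

sortPair-∈-edges : ∀ {n} (G : SimpleGraph n) {a b} → Adj G a b ≡ true → sortPair a b ∈ edges G
sortPair-∈-edges G {a} {b} e with a ≤? b
... | yes a≤b = ∈-edges⁺ G (e , ≤∧≢⇒< a≤b (adj⇒≢ G e))
... | no  a≰b = ∈-edges⁺ G (adj-sym G e , ≰⇒> a≰b)

module Factorisation {n} (G H K : SimpleGraph n)
  (factor : ∀ i j → adjMatrix G i j ≡ (adjMatrix H ⊗ adjMatrix K) i j) where

  Path : Fin n → Fin n → Fin n → Set
  Path i j k = Adj H i k ≡ true × Adj K k j ≡ true

  path? : ∀ i j → Decidable (Path i j)
  path? i j k = (Adj H i k ≟ᵇ true) ×-dec (Adj K k j ≟ᵇ true)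

  summand : Fin n → Fin n → Fin n → ℕ
  summand i j k = adjMatrix H i k * adjMatrix K k j

  path⇒summand≡1 : ∀ {i j k} → Path i j k → summand i j k ≡ 1
  path⇒summand≡1 (hik , kkj) rewrite hik | kkj = refl

  ¬path⇒summand≡0 : ∀ {i j k} → ¬ Path i j k → summand i j k ≡ 0
  ¬path⇒summand≡0 {i} {j} {k} ¬p with Adj H i k | Adj K k j
  ... | true  | true  = contradiction (refl , refl) ¬p
  ... | true  | false = refl
  ... | false | _     = refl

  path⇒adj : ∀ {i j k} → Path i j k → Adj G i j ≡ true
  path⇒adj {i} {j} {k} p with Adj G i j | factor i j
  ... | true  | _    = refl
  ... | false | 0≡∑ = contradiction 1≤0 λ ()
    where
    open ≤-Reasoning
    1≤0 : 1 ℕ.≤ 0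
    1≤0 = begin
      1                ≡⟨ sym (path⇒summand≡1 p) ⟩
      summand i j k    ≤⟨ ∑-≥-summand (summand i j) k ⟩
      ∑ (summand i j)  ≡⟨ sym 0≡∑ ⟩
      0                ∎

  path-unique : ∀ {i j k k′} → Path i j k → Path i j k′ → k ≡ k′
  path-unique {i} {j} {k} {k′} p p′ with k ≟ k′
  ... | yes k≡k′ = k≡k′
  ... | no  k≢k′ = contradiction 2≤1 λ { (ℕ.s≤s ()) }
    where
    open ≤-Reasoning
    2≤1 : 2 ℕ.≤ 1
    2≤1 = begin
      2                               ≡⟨ sym (cong₂ _+_ (path⇒summand≡1 p) (path⇒summand≡1 p′)) ⟩
      summand i j k + summand i j k′  ≤⟨ ∑-≥-pair (summand i j) k≢k′ ⟩
      ∑ (summand i j)                 ≡⟨ sym (factor i j) ⟩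
      adjMatrix G i j                 ≤⟨ adjMatrix≤1 G i j ⟩
      1                               ∎

  -- When i and j are not adjacent no k with Path i j k exists, and i is a junk value.
  mid : Fin n → Fin n → Fin n
  mid i j with any? (path? i j)
  ... | yes (k , _) = k
  ... | no  _       = i

  adj⇒path : ∀ {i j} → Adj G i j ≡ true → Path i j (mid i j)
  adj⇒path {i} {j} e with any? (path? i j)
  ... | yes (_ , p) = p
  ... | no  ¬∃ = contradiction
    (trans (sym (adj⇒adjMatrix≡1 G e))
      (trans (factor i j) (∑-zero (summand i j) λ k → ¬path⇒summand≡0 (¬∃ ∘ (k ,_)))))
    λ ()

  path-rotate : ∀ {i j k k′} → Path i j k → Path j i k′ → Path k k′ i
  path-rotate (hik , _) (_ , kk′i) = adj-sym H hik , adj-sym K kk′i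

  module _ {i j} (e : Adj G i j ≡ true) where

    path-mid-mid : Path (mid i j) (mid j i) i
    path-mid-mid = path-rotate (adj⇒path e) (adj⇒path (adj-sym G e))

    mid-adj : Adj G (mid i j) (mid j i) ≡ true
    mid-adj = path⇒adj path-mid-mid

    mid-mid : mid (mid i j) (mid j i) ≡ i
    mid-mid = sym (path-unique path-mid-mid (adj⇒path mid-adj))

    mid≢source : mid i j ≢ i
    mid≢source = adj⇒≢ H (proj₁ (adj⇒path e)) ∘ sym

    mid≢target : mid i j ≢ j
    mid≢target = adj⇒≢ K (proj₂ (adj⇒path e))

  partner : Fin n × Fin n → Fin n × Fin n
  partner (i , j) = sortPair (mid i j) (mid j i)

  partner-sortPair : ∀ a b → partner (sortPair a b) ≡ partner (a , b)
  partner-sortPair a b =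
    [ cong partner , (λ eq → trans (cong partner eq) (sortPair-comm (mid b a) (mid a b))) ]′
      (sortPair-cases a b)

  partner-freeInvolution : FreeInvolutionOn partner (edges G)
  partner-freeInvolution = record
    { closed       = λ {p} p∈ → closed p (∈-edges⁻ G p∈)
    ; involutive   = λ {p} p∈ → involutive p (∈-edges⁻ G p∈)
    ; fixpointFree = λ {p} p∈ → fixpointFree p (∈-edges⁻ G p∈)
    }
    where
    closed : ∀ p → IsEdge G p → partner p ∈ edges G
    closed (i , j) (e , _) = sortPair-∈-edges G (mid-adj {i} {j} e)

    involutive : ∀ p → IsEdge G p → partner (partner p) ≡ p
    involutive (i , j) (e , i<j) = begin
      partner (sortPair (mid i j) (mid j i))  ≡⟨ partner-sortPair (mid i j) (mid j i) ⟩
      partner (mid i j , mid j i)             ≡⟨ cong₂ sortPair (mid-mid {i} {j} e)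
                                                                  (mid-mid {j} {i} (adj-sym G e)) ⟩
      sortPair i j                            ≡⟨ sortPair-< i<j ⟩
      (i , j)                                 ∎
      where open ≡-Reasoning

    fixpointFree : ∀ p → IsEdge G p → partner p ≢ p
    fixpointFree (i , j) (e , _) fixed with sortPair-cases (mid i j) (mid j i)
    ... | inj₁ sorted  = mid≢source {i} {j} e (cong proj₁ (trans (sym sorted) fixed))
    ... | inj₂ swapped = mid≢target {i} {j} e (cong proj₂ (trans (sym swapped) fixed))

factorable⇒2∣|edges| : ∀ {n} {G : SimpleGraph n} → Factorable G → 2 ∣ length (edges G)
factorable⇒2∣|edges| {G = G} (H , K , factor) =
  freeInvolution⇒2∣length (≡-dec _≟_ _≟_) (edges-unique G)
    (Factorisation.partner-freeInvolution G H K factor)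

petersen-|edges|≡15 : length (edges Petersen) ≡ 15
petersen-|edges|≡15 = refl

mainTheorem16 : ¬ Factorable Petersen
mainTheorem16 factorable =
  from-no (2 ∣? 15)
    (subst (2 ∣_) petersen-|edges|≡15 (factorable⇒2∣|edges| {G = Petersen} factorable))
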